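{- Let $d\ge 1$ and $n\ge 0$ be integers, and let $\mathrm{s}=((1-d)/2,(3-d)/2,\dots,(d-3)/2,(d-1)/2)\in\mathbb{R}^d$ be the standard offset vector. Then the number of vectors $p\in\mathbb{R}^d$ such that the points $p+\sigma(\mathrm{s})$, $\sigma\in\mathfrak{S}_d$, are $d!$ distinct vertices of $\mathrm{SR}(d,n)$ (equivalently, such that $\mathbf{H}_{p,\mathrm{s}}=\sum_{\sigma\in\mathfrak{S}_d}\varepsilon(\sigma)\mathbf{e}_{p+\sigma(\mathrm{s})}$ is defined and hence is an eigenvector of the adjacency matrix of $\mathrm{SR}(d,n)$ with eigenvalue $-\binom d2$) is \[\binom{n-\frac{(d-1)(d-2)}{2}}{d-1}.\]
   Context: $\mathrm{SR}(d,n)$ has vertex set $V(d,n)=\{x\in\mathbb{Z}_{\ge0}^d:\sum_i x_i=n\}$, two vertices adjacent if they differ in exactly two coordinates; $\mathbb{R}^N$, $N=|V(d,n)|$, has standard basis $\{\mathbf{e}_x:x\in V(d,n)\}$. $\mathfrak{S}_d$ acts on $\mathbb{R}^d$ by permuting coordinates and $\varepsilon$ is the sign character. Binomial coefficients $\binom{m}{k}$ with $m<k$ (including negative $m$) are interpreted as $0$.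
   Formalization: The vectors p being counted range over ℚ^d instead of ℝ^d. -}

module Defs where

open import Data.Nat as ℕ using (ℕ; _∸_; _*_; _/_)
open import Data.Nat.Combinatorics using (_C_)
open import Data.Integer as ℤ using (ℤ; +_; -[1+_])
open import Data.Rational as ℚ using (ℚ)
open import Data.Fin using (Fin; toℕ)
open import Data.Fin.Permutation using (Permutation′; _⟨$⟩ʳ_; _≈_)
open import Data.Vec using (Vec; tabulate; lookup; zipWith; map; sum)
open import Data.Product using (Σ; _×_)
open import Relation.Binary.PropositionalEquality using (_≡_)

binomℤ : ℤ → ℕ → ℕ
binomℤ (+ m)    k = m C k
binomℤ -[1+ m ] k = 0

offset : (d : ℕ) → Vec ℚ d
offset d = tabulate (λ i → (+ (2 * toℕ i ℕ.+ 1) ℤ.- + d) ℚ./ 2)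

permuteVec : ∀ {d} → Permutation′ d → Vec ℚ d → Vec ℚ d
permuteVec σ v = tabulate (λ i → lookup v (σ ⟨$⟩ʳ i))

_+ᵛ_ : ∀ {d} → Vec ℚ d → Vec ℚ d → Vec ℚ d
_+ᵛ_ = zipWith ℚ._+_

-- q is a vertex of SR(d,n): q ∈ ℤ_{≥0}^d with coordinate sum n
IsVertex : (d n : ℕ) → Vec ℚ d → Set
IsVertex d n q = Σ (Vec ℕ d) (λ x → (map (λ k → (+ k) ℚ./ 1) x ≡ q) × (sum x ≡ n))

Good : (d n : ℕ) → Vec ℚ d → Set
Good d n p =
  ((σ : Permutation′ d) → IsVertex d n (p +ᵛ permuteVec σ (offset d)))
  × ((σ τ : Permutation′ d) →
       p +ᵛ permuteVec σ (offset d) ≡ p +ᵛ permuteVec τ (offset d) → σ ≈ τ)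

-- Write p = y + ((d-1)/2)·𝟙.  Since the entries of s are (d-1)/2 less than 0, 1, …, d-1, the
-- point p + σ(s) is the vector with coordinates y_i + σ(i).  These are vertices of SR(d,n) for
-- every σ iff y ∈ ℕ^d (take σ with σ(i) = 0 to see y_i ∈ ℕ) and Σ y + d(d-1)/2 = n; they are
-- then pairwise distinct because s has distinct entries.  So the admissible p correspond to
-- weak compositions of n - d(d-1)/2 into d parts, of which there are C(n - (d-1)(d-2)/2, d-1).
module Submission where

open import Defs
open import Data.Nat using (ℕ; _≤_; _∸_; _*_; _/_)
open import Data.Integer using (+_; _-_)
open import Data.Rational using (ℚ)
open import Data.Vec using (Vec)
open import Data.List using (List; length)
open import Data.List.Relation.Unary.Unique.Propositional using (Unique)
open import Data.List.Membership.Propositional using (_∈_)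
open import Data.Product using (Σ; _×_)
open import Relation.Binary.PropositionalEquality using (_≡_)

open import Data.Nat using (zero; suc; _+_; _<_; _≤?_)
import Data.Nat.Properties as ℕP
open import Data.Nat.DivMod using (m*n/n≡m)
open import Data.Nat.Combinatorics using (_C_; nCn≡1; nCk+nC[k+1]≡[n+1]C[k+1]; k>n⇒nCk≡0)
open import Data.Nat.Tactic.RingSolver using () renaming (solve-∀ to solveℕ)
open import Data.Integer as ℤ using (ℤ)
import Data.Integer.Properties as ℤP
open import Data.Integer.Tactic.RingSolver using () renaming (solve-∀ to solveℤ)
open import Data.Rational as ℚ using (fromℚᵘ; toℚᵘ)
import Data.Rational.Properties as ℚP
open import Data.Rational.Unnormalised as ℚᵘ using (mkℚᵘ; *≡*)
import Data.Rational.Unnormalised.Properties as ℚᵘP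
open import Algebra.Properties.Group ℚP.+-0-group using (∙-cancelˡ; ∙-cancelʳ)
open import Data.Fin as F using (Fin; toℕ)
import Data.Fin.Properties as FP
open import Data.Fin.Permutation as Perm using (Permutation′; _⟨$⟩ʳ_; _≈_)
import Data.Fin.Permutation.Components as PC
open import Data.Vec as V using ([]; _∷_; sum; tabulate; lookup)
import Data.Vec.Properties as VP
open import Data.Vec.Relation.Binary.Pointwise.Extensional using (ext; Pointwise-≡⇒≡)
open import Algebra.Properties.CommutativeMonoid.Sum ℕP.+-0-commutativeMonoid
  using (sum-permute; ∑-distrib-+; sum-init-last; sum-cong-≗) renaming (sum to ∑)
open import Data.List as L using ([_]; _++_)
import Data.List.Properties as LP
import Data.List.Relation.Unary.Unique.Propositional.Properties as UniqueP
open import Data.List.Relation.Unary.All using ([])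
open import Data.List.Relation.Unary.AllPairs using ([]; _∷_)
open import Data.List.Relation.Unary.Any using (here)
open import Data.List.Membership.Propositional.Properties using (∈-map⁺; ∈-map⁻; ∈-++⁺ˡ; ∈-++⁺ʳ; ∈-++⁻)
open import Data.Product using (_,_; proj₁; proj₂; ∃)
open import Data.Sum using (inj₁; inj₂)
open import Relation.Nullary using (¬_; yes; no; contradiction)
open import Relation.Nullary.Decidable using (dec-true)
open import Relation.Binary.PropositionalEquality using (refl; sym; trans; cong; cong₂; subst; module ≡-Reasoning)

fromℕ : ℕ → ℚ
fromℕ m = + m ℚ./ 1

-- Since a / suc n is fromℚᵘ (mkℚᵘ a n) by definition, identities between fractions can be
-- checked by cross-multiplication in ℚᵘ.
fromℚᵘ-homo-+ : ∀ p q → fromℚᵘ (p ℚᵘ.+ q) ≡ fromℚᵘ p ℚ.+ fromℚᵘ q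
fromℚᵘ-homo-+ p q = ℚP.toℚᵘ-injective (begin
  toℚᵘ (fromℚᵘ (p ℚᵘ.+ q))            ≈⟨ ℚP.toℚᵘ-fromℚᵘ (p ℚᵘ.+ q) ⟩
  p ℚᵘ.+ q                            ≈⟨ ℚᵘP.+-cong (ℚᵘP.≃-sym (ℚP.toℚᵘ-fromℚᵘ p)) (ℚᵘP.≃-sym (ℚP.toℚᵘ-fromℚᵘ q)) ⟩
  toℚᵘ (fromℚᵘ p) ℚᵘ.+ toℚᵘ (fromℚᵘ q) ≈⟨ ℚᵘP.≃-sym (ℚP.toℚᵘ-homo-+ (fromℚᵘ p) (fromℚᵘ q)) ⟩
  toℚᵘ (fromℚᵘ p ℚ.+ fromℚᵘ q)         ∎)
  where open ℚᵘP.≃-Reasoning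

fromℕ-homo-+ : ∀ m n → fromℕ (m + n) ≡ fromℕ m ℚ.+ fromℕ n
fromℕ-homo-+ m n = trans (ℚP.fromℚᵘ-cong {mkℚᵘ (+ (m + n)) 0} {mkℚᵘ (+ m) 0 ℚᵘ.+ mkℚᵘ (+ n) 0} (*≡* eq)) (fromℚᵘ-homo-+ (mkℚᵘ (+ m) 0) (mkℚᵘ (+ n) 0))
  where
  eq : + (m + n) ℤ.* + 1 ≡ (+ m ℤ.* + 1 ℤ.+ + n ℤ.* + 1) ℤ.* + 1
  eq = trans (cong (ℤ._* + 1) (ℤP.pos-+ m n)) (identity (+ m) (+ n))
    where
    identity : ∀ M N → (M ℤ.+ N) ℤ.* + 1 ≡ (M ℤ.* + 1 ℤ.+ N ℤ.* + 1) ℤ.* + 1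
    identity = solveℤ

fromℕ-injective : ∀ {m n} → fromℕ m ≡ fromℕ n → m ≡ n
fromℕ-injective {m} {n} eq with ℚP.fromℚᵘ-injective {mkℚᵘ (+ m) 0} {mkℚᵘ (+ n) 0} eq
... | *≡* m≡n = ℤP.+-injective (trans (sym (ℤP.*-identityʳ (+ m))) (trans m≡n (ℤP.*-identityʳ (+ n))))

centre : ℕ → ℚ
centre d = + (d ∸ 1) ℚ./ 2

lookup-offset : ∀ {d} (j : Fin d) → lookup (offset d) j ℚ.+ centre d ≡ fromℕ (toℕ j)
lookup-offset {suc k} j = begin
  lookup (offset (suc k)) j ℚ.+ centre (suc k)  ≡⟨ cong (ℚ._+ centre (suc k)) (VP.lookup∘tabulate (λ i → (+ (2 * toℕ i + 1) - + suc k) ℚ./ 2) j) ⟩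
  fromℚᵘ (mkℚᵘ sⱼ 1) ℚ.+ fromℚᵘ (mkℚᵘ (+ k) 1) ≡⟨ sym (fromℚᵘ-homo-+ (mkℚᵘ sⱼ 1) (mkℚᵘ (+ k) 1)) ⟩
  fromℚᵘ (mkℚᵘ sⱼ 1 ℚᵘ.+ mkℚᵘ (+ k) 1)         ≡⟨ ℚP.fromℚᵘ-cong {mkℚᵘ sⱼ 1 ℚᵘ.+ mkℚᵘ (+ k) 1} {mkℚᵘ (+ toℕ j) 0} (*≡* eq) ⟩
  fromℕ (toℕ j)                                 ∎
  where
  open ≡-Reasoning
  sⱼ : ℤ
  sⱼ = + (2 * toℕ j + 1) - + suc k
  identity : ∀ J K → ((+ 2 ℤ.* J ℤ.+ + 1 - (+ 1 ℤ.+ K)) ℤ.* + 2 ℤ.+ K ℤ.* + 2) ℤ.* + 1 ≡ J ℤ.* + 4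
  identity = solveℤ
  eq : (sⱼ ℤ.* + 2 ℤ.+ + k ℤ.* + 2) ℤ.* + 1 ≡ + toℕ j ℤ.* + 4
  eq = trans (cong (λ z → ((z ℤ.+ + 1 - + suc k) ℤ.* + 2 ℤ.+ + k ℤ.* + 2) ℤ.* + 1) (ℤP.pos-* 2 (toℕ j)))
             (identity (+ toℕ j) (+ k))

shift : ∀ {d} → Vec ℕ d → Vec ℚ d
shift {d} = V.map (λ a → fromℕ a ℚ.+ centre d)

shift-injective : ∀ {d} {x y : Vec ℕ d} → shift x ≡ shift y → x ≡ y
shift-injective {d} {x} {y} eq = Pointwise-≡⇒≡ (ext λ i → fromℕ-injective (∙-cancelʳ (centre d) _ _ (begin
  fromℕ (lookup x i) ℚ.+ centre d  ≡⟨ VP.lookup-map i _ x ⟨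
  lookup (shift x) i               ≡⟨ cong (λ v → lookup v i) eq ⟩
  lookup (shift y) i               ≡⟨ VP.lookup-map i _ y ⟩
  fromℕ (lookup y i) ℚ.+ centre d  ∎)))
  where open ≡-Reasoning

shift-offset : ∀ {d} a (j : Fin d) → (fromℕ a ℚ.+ centre d) ℚ.+ lookup (offset d) j ≡ fromℕ (a + toℕ j)
shift-offset {d} a j = begin
  (fromℕ a ℚ.+ centre d) ℚ.+ lookup (offset d) j ≡⟨ ℚP.+-assoc (fromℕ a) (centre d) (lookup (offset d) j) ⟩
  fromℕ a ℚ.+ (centre d ℚ.+ lookup (offset d) j) ≡⟨ cong (fromℕ a ℚ.+_) (ℚP.+-comm (centre d) (lookup (offset d) j)) ⟩
  fromℕ a ℚ.+ (lookup (offset d) j ℚ.+ centre d) ≡⟨ cong (fromℕ a ℚ.+_) (lookup-offset j) ⟩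
  fromℕ a ℚ.+ fromℕ (toℕ j)                       ≡⟨ sym (fromℕ-homo-+ a (toℕ j)) ⟩
  fromℕ (a + toℕ j)                               ∎
  where open ≡-Reasoning

lookup-offset-injective : ∀ {d} {i j : Fin d} → lookup (offset d) i ≡ lookup (offset d) j → i ≡ j
lookup-offset-injective {d} {i} {j} eq = FP.toℕ-injective (fromℕ-injective (begin
  fromℕ (toℕ i)                      ≡⟨ sym (lookup-offset i) ⟩
  lookup (offset d) i ℚ.+ centre d   ≡⟨ cong (ℚ._+ centre d) eq ⟩
  lookup (offset d) j ℚ.+ centre d   ≡⟨ lookup-offset j ⟩
  fromℕ (toℕ j)                      ∎))
  where open ≡-Reasoning

lookup-translate : ∀ {d} (p : Vec ℚ d) (σ : Permutation′ d) i →
  lookup (p +ᵛ permuteVec σ (offset d)) i ≡ lookup p i ℚ.+ lookup (offset d) (σ ⟨$⟩ʳ i)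
lookup-translate {d} p σ i = trans (VP.lookup-zipWith ℚ._+_ i p (permuteVec σ (offset d)))
  (cong (lookup p i ℚ.+_) (VP.lookup∘tabulate (λ j → lookup (offset d) (σ ⟨$⟩ʳ j)) i))

lookup-shift-translate : ∀ {d} (y : Vec ℕ d) (σ : Permutation′ d) i →
  lookup (shift y +ᵛ permuteVec σ (offset d)) i ≡ fromℕ (lookup y i + toℕ (σ ⟨$⟩ʳ i))
lookup-shift-translate {d} y σ i = begin
  lookup (shift y +ᵛ permuteVec σ (offset d)) i                        ≡⟨ lookup-translate (shift y) σ i ⟩
  lookup (shift y) i ℚ.+ lookup (offset d) (σ ⟨$⟩ʳ i)                  ≡⟨ cong (ℚ._+ lookup (offset d) (σ ⟨$⟩ʳ i)) (VP.lookup-map i _ y) ⟩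
  (fromℕ (lookup y i) ℚ.+ centre d) ℚ.+ lookup (offset d) (σ ⟨$⟩ʳ i) ≡⟨ shift-offset (lookup y i) (σ ⟨$⟩ʳ i) ⟩
  fromℕ (lookup y i + toℕ (σ ⟨$⟩ʳ i))                                 ∎
  where open ≡-Reasoning

translate-injective : ∀ {d} (p : Vec ℚ d) (σ τ : Permutation′ d) →
  p +ᵛ permuteVec σ (offset d) ≡ p +ᵛ permuteVec τ (offset d) → σ ≈ τ
translate-injective {d} p σ τ eq i = lookup-offset-injective (∙-cancelˡ (lookup p i) _ _ (begin
  lookup p i ℚ.+ lookup (offset d) (σ ⟨$⟩ʳ i)  ≡⟨ sym (lookup-translate p σ i) ⟩
  lookup (p +ᵛ permuteVec σ (offset d)) i      ≡⟨ cong (λ q → lookup q i) eq ⟩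
  lookup (p +ᵛ permuteVec τ (offset d)) i      ≡⟨ lookup-translate p τ i ⟩
  lookup p i ℚ.+ lookup (offset d) (τ ⟨$⟩ʳ i)  ∎))
  where open ≡-Reasoning

sum-tabulate : ∀ {n} (f : Fin n → ℕ) → sum (tabulate f) ≡ ∑ f
sum-tabulate {zero}  f = refl
sum-tabulate {suc n} f = cong (_+_ (f F.zero)) (sum-tabulate (λ i → f (F.suc i)))

triangle : ℕ → ℕ
triangle zero    = 0
triangle (suc k) = triangle k + k

∑-toℕ : ∀ n → ∑ {n} toℕ ≡ triangle n
∑-toℕ zero    = refl
∑-toℕ (suc n) = begin
  ∑ {suc n} toℕ                                      ≡⟨ sum-init-last {n} toℕ ⟩
  ∑ {n} (λ i → toℕ (F.inject₁ i)) + toℕ (F.fromℕ n)  ≡⟨ cong₂ _+_ (sum-cong-≗ {n} FP.toℕ-inject₁) (FP.toℕ-fromℕ n) ⟩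
  ∑ {n} toℕ + n                                      ≡⟨ cong (_+ n) (∑-toℕ n) ⟩
  triangle n + n                                     ∎
  where open ≡-Reasoning

triangle-closed : ∀ k → (k * (k ∸ 1)) / 2 ≡ triangle k
triangle-closed k = trans (cong (_/ 2) (sym (twice-triangle k))) (m*n/n≡m (triangle k) 2)
  where
  twice-triangle : ∀ k → triangle k * 2 ≡ k * (k ∸ 1)
  twice-triangle zero          = refl
  twice-triangle (suc zero)    = refl
  twice-triangle (suc (suc k)) = begin
    (triangle (suc k) + suc k) * 2     ≡⟨ ℕP.*-distribʳ-+ 2 (triangle (suc k)) (suc k) ⟩
    triangle (suc k) * 2 + suc k * 2   ≡⟨ cong (_+ suc k * 2) (twice-triangle (suc k)) ⟩
    suc k * k + suc k * 2              ≡⟨ identity k ⟩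
    suc (suc k) * suc k                ∎
    where
    open ≡-Reasoning
    identity : ∀ k → suc k * k + suc k * 2 ≡ suc (suc k) * suc k
    identity = solveℕ

sum-+-permuted-toℕ : ∀ {d} (y : Vec ℕ d) (σ : Permutation′ d) →
  sum (tabulate (λ i → lookup y i + toℕ (σ ⟨$⟩ʳ i))) ≡ sum y + triangle d
sum-+-permuted-toℕ {d} y σ = begin
  sum (tabulate (λ i → lookup y i + toℕ (σ ⟨$⟩ʳ i))) ≡⟨ sum-tabulate (λ i → lookup y i + toℕ (σ ⟨$⟩ʳ i)) ⟩
  ∑ (λ i → lookup y i + toℕ (σ ⟨$⟩ʳ i))             ≡⟨ ∑-distrib-+ (lookup y) (λ i → toℕ (σ ⟨$⟩ʳ i)) ⟩
  ∑ (lookup y) + ∑ (λ i → toℕ (σ ⟨$⟩ʳ i))           ≡⟨ cong₂ _+_ (sym (sum-tabulate (lookup y))) (sym (sum-permute {d} toℕ σ)) ⟩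
  sum (tabulate (lookup y)) + ∑ {d} toℕ             ≡⟨ cong₂ _+_ (cong sum (VP.tabulate∘lookup y)) (∑-toℕ d) ⟩
  sum y + triangle d                                 ∎
  where open ≡-Reasoning

vertex-coordinate : ∀ {d n} {p : Vec ℚ d} (σ : Permutation′ d) ((x , _) : IsVertex d n (p +ᵛ permuteVec σ (offset d))) i →
  fromℕ (lookup x i) ≡ lookup p i ℚ.+ lookup (offset d) (σ ⟨$⟩ʳ i)
vertex-coordinate {p = p} σ (x , q≡x , _) i = begin
  fromℕ (lookup x i)                              ≡⟨ VP.lookup-map i fromℕ x ⟨
  lookup (V.map fromℕ x) i                        ≡⟨ cong (λ v → lookup v i) q≡x ⟩
  lookup (p +ᵛ permuteVec σ (offset _)) i         ≡⟨ lookup-translate p σ i ⟩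
  lookup p i ℚ.+ lookup (offset _) (σ ⟨$⟩ʳ i)     ∎
  where open ≡-Reasoning

shift-good : ∀ {d n} (y : Vec ℕ d) → sum y + triangle d ≡ n → Good d n (shift y)
shift-good {d} y Σy≡n = isVertex , translate-injective (shift y)
  where
  isVertex : (σ : Permutation′ d) → IsVertex d _ (shift y +ᵛ permuteVec σ (offset d))
  isVertex σ = x , Pointwise-≡⇒≡ (ext coordinate) , trans (sum-+-permuted-toℕ y σ) Σy≡n
    where
    x : Vec ℕ d
    x = tabulate (λ i → lookup y i + toℕ (σ ⟨$⟩ʳ i))
    coordinate : ∀ i → lookup (V.map fromℕ x) i ≡ lookup (shift y +ᵛ permuteVec σ (offset d)) i
    coordinate i = begin
      lookup (V.map fromℕ x) i              ≡⟨ VP.lookup-map i fromℕ x ⟩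
      fromℕ (lookup x i)                    ≡⟨ cong fromℕ (VP.lookup∘tabulate (λ i → lookup y i + toℕ (σ ⟨$⟩ʳ i)) i) ⟩
      fromℕ (lookup y i + toℕ (σ ⟨$⟩ʳ i))   ≡⟨ sym (lookup-shift-translate y σ i) ⟩
      lookup (shift y +ᵛ permuteVec σ (offset d)) i ∎
      where open ≡-Reasoning

transpose-matchˡ : ∀ {n} (i j : Fin n) → PC.transpose i j i ≡ j
transpose-matchˡ i j rewrite dec-true (i F.≟ i) refl = refl

-- The smallest offset entry is s₀ = -centre, so the vertex for a permutation sending i to 0
-- has i-th coordinate p i - centre.
good-coordinate : ∀ {k n p} → Good (suc k) n p → ∀ i → ∃ λ a → lookup p i ≡ fromℕ a ℚ.+ centre (suc k)
good-coordinate {k} {p = p} (isVertex , _) i = lookup x i , (begin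
  lookup p i                                              ≡⟨ ℚP.+-identityʳ (lookup p i) ⟨
  lookup p i ℚ.+ fromℕ 0                                  ≡⟨ cong (lookup p i ℚ.+_) (lookup-offset {suc k} F.zero) ⟨
  lookup p i ℚ.+ (lookup s F.zero ℚ.+ centre (suc k))     ≡⟨ ℚP.+-assoc (lookup p i) (lookup s F.zero) (centre (suc k)) ⟨
  (lookup p i ℚ.+ lookup s F.zero) ℚ.+ centre (suc k)     ≡⟨ cong (λ j → (lookup p i ℚ.+ lookup s j) ℚ.+ centre (suc k)) (transpose-matchˡ i F.zero) ⟨
  (lookup p i ℚ.+ lookup s (σ ⟨$⟩ʳ i)) ℚ.+ centre (suc k) ≡⟨ cong (ℚ._+ centre (suc k)) (vertex-coordinate σ (isVertex σ) i) ⟨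
  fromℕ (lookup x i) ℚ.+ centre (suc k)                   ∎)
  where
  open ≡-Reasoning
  s = offset (suc k)
  σ = Perm.transpose i F.zero
  x = proj₁ (isVertex σ)

good⇒shift : ∀ {k n p} → Good (suc k) n p → ∃ λ y → p ≡ shift y × sum y + triangle (suc k) ≡ n
good⇒shift {k} {n} {p} good@(isVertex , _) = y , Pointwise-≡⇒≡ (ext p≡shift-y) , Σy≡n
  where
  open ≡-Reasoning
  y : Vec ℕ (suc k)
  y = tabulate (λ i → proj₁ (good-coordinate good i))
  p≡shift-y : ∀ i → lookup p i ≡ lookup (shift y) i
  p≡shift-y i = begin
    lookup p i                                ≡⟨ proj₂ (good-coordinate good i) ⟩
    fromℕ (proj₁ (good-coordinate good i)) ℚ.+ centre (suc k)
      ≡⟨ cong (λ a → fromℕ a ℚ.+ centre (suc k)) (VP.lookup∘tabulate (λ i → proj₁ (good-coordinate good i)) i) ⟨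
    fromℕ (lookup y i) ℚ.+ centre (suc k)     ≡⟨ VP.lookup-map i _ y ⟨
    lookup (shift y) i                        ∎
  x : Vec ℕ (suc k)
  x = proj₁ (isVertex Perm.id)
  x≡y+toℕ : ∀ i → lookup x i ≡ lookup y i + toℕ i
  x≡y+toℕ i = fromℕ-injective (begin
    fromℕ (lookup x i)                                                 ≡⟨ vertex-coordinate Perm.id (isVertex Perm.id) i ⟩
    lookup p i ℚ.+ lookup (offset (suc k)) i                           ≡⟨ cong (ℚ._+ lookup (offset (suc k)) i) (p≡shift-y i) ⟩
    lookup (shift y) i ℚ.+ lookup (offset (suc k)) i                   ≡⟨ lookup-translate (shift y) Perm.id i ⟨
    lookup (shift y +ᵛ permuteVec Perm.id (offset (suc k))) i          ≡⟨ lookup-shift-translate y Perm.id i ⟩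
    fromℕ (lookup y i + toℕ i)                                         ∎)
  Σy≡n : sum y + triangle (suc k) ≡ n
  Σy≡n = begin
    sum y + triangle (suc k)                      ≡⟨ sum-+-permuted-toℕ y Perm.id ⟨
    sum (tabulate (λ i → lookup y i + toℕ i))     ≡⟨ cong sum (VP.tabulate-cong (λ i → sym (x≡y+toℕ i))) ⟩
    sum (tabulate (lookup x))                     ≡⟨ cong sum (VP.tabulate∘lookup x) ⟩
    sum x                                         ≡⟨ proj₂ (proj₂ (isVertex Perm.id)) ⟩
    n                                             ∎

incrementHead : ∀ {d} → Vec ℕ (suc d) → Vec ℕ (suc d)
incrementHead (a ∷ xs) = suc a ∷ xs

compositions : (d m : ℕ) → List (Vec ℕ d)
compositions zero    zero    = [ [] ]
compositions zero    (suc m) = L.[]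
compositions (suc d) zero    = L.map (0 ∷_) (compositions d zero)
compositions (suc d) (suc m) = L.map (0 ∷_) (compositions d (suc m)) ++ L.map incrementHead (compositions (suc d) m)

∈-compositions⁻ : ∀ {d m} {x : Vec ℕ d} → x ∈ compositions d m → sum x ≡ m
∈-compositions⁻ {zero}  {zero}  (here refl) = refl
∈-compositions⁻ {suc d} {zero}  x∈ with ∈-map⁻ (0 ∷_) x∈
... | _ , xs∈ , refl = ∈-compositions⁻ xs∈
∈-compositions⁻ {suc d} {suc m} x∈ with ∈-++⁻ (L.map (0 ∷_) (compositions d (suc m))) x∈
... | inj₁ x∈₁ with ∈-map⁻ (0 ∷_) x∈₁
...   | _ , xs∈ , refl = ∈-compositions⁻ xs∈
∈-compositions⁻ {suc d} {suc m} x∈ | inj₂ x∈₂ with ∈-map⁻ incrementHead x∈₂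
...   | _ ∷ _ , x′∈ , refl = cong suc (∈-compositions⁻ x′∈)

∈-compositions⁺ : ∀ {d} (x : Vec ℕ d) → x ∈ compositions d (sum x)
∈-compositions⁺ []       = here refl
∈-compositions⁺ (a ∷ xs) = cons a (∈-compositions⁺ xs)
  where
  cons : ∀ {d} {xs : Vec ℕ d} a → xs ∈ compositions d (sum xs) → (a ∷ xs) ∈ compositions (suc d) (a + sum xs)
  cons {xs = xs} zero    xs∈ with sum xs
  ... | zero  = ∈-map⁺ (0 ∷_) xs∈
  ... | suc _ = ∈-++⁺ˡ (∈-map⁺ (0 ∷_) xs∈)
  cons {d} {xs} (suc a) xs∈ = ∈-++⁺ʳ (L.map (0 ∷_) (compositions d (suc (a + sum xs)))) (∈-map⁺ incrementHead (cons a xs∈))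

compositions-unique : ∀ d m → Unique (compositions d m)
compositions-unique zero    zero    = [] ∷ []
compositions-unique zero    (suc m) = []
compositions-unique (suc d) zero    = UniqueP.map⁺ VP.∷-injectiveʳ (compositions-unique d zero)
compositions-unique (suc d) (suc m) = UniqueP.++⁺ (UniqueP.map⁺ VP.∷-injectiveʳ (compositions-unique d (suc m)))
  (UniqueP.map⁺ incrementHead-injective (compositions-unique (suc d) m)) disjoint
  where
  incrementHead-injective : ∀ {x y : Vec ℕ (suc d)} → incrementHead x ≡ incrementHead y → x ≡ y
  incrementHead-injective {_ ∷ _} {_ ∷ _} refl = refl
  disjoint : ∀ {v} → ¬ (v ∈ L.map (0 ∷_) (compositions d (suc m)) × v ∈ L.map incrementHead (compositions (suc d) m))
  disjoint (v∈₁ , v∈₂) with ∈-map⁻ (0 ∷_) v∈₁ | ∈-map⁻ incrementHead v∈₂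
  ... | _ , _ , refl | _ ∷ _ , _ , ()

length-compositions : ∀ d m → length (compositions (suc d) m) ≡ (m + d) C d
length-compositions d zero = trans (length-zero (suc d)) (sym (nCn≡1 d))
  where
  length-zero : ∀ d → length (compositions d zero) ≡ 1
  length-zero zero    = refl
  length-zero (suc d) = trans (LP.length-map (0 ∷_) (compositions d zero)) (length-zero d)
length-compositions zero (suc m) = trans (LP.length-map incrementHead (compositions 1 m)) (length-compositions zero m)
length-compositions (suc d) (suc m) = begin
  length (L.map (0 ∷_) (compositions (suc d) (suc m)) ++ L.map incrementHead (compositions (suc (suc d)) m))
    ≡⟨ LP.length-++ (L.map (0 ∷_) (compositions (suc d) (suc m))) ⟩
  length (L.map (0 ∷_) (compositions (suc d) (suc m))) + length (L.map incrementHead (compositions (suc (suc d)) m))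
    ≡⟨ cong₂ _+_ (LP.length-map (0 ∷_) (compositions (suc d) (suc m))) (LP.length-map incrementHead (compositions (suc (suc d)) m)) ⟩
  length (compositions (suc d) (suc m)) + length (compositions (suc (suc d)) m)
    ≡⟨ cong₂ _+_ (length-compositions d (suc m)) (length-compositions (suc d) m) ⟩
  (suc m + d) C d + (m + suc d) C suc d
    ≡⟨ cong (λ t → t C d + (m + suc d) C suc d) (sym (ℕP.+-suc m d)) ⟩
  (m + suc d) C d + (m + suc d) C suc d
    ≡⟨ nCk+nC[k+1]≡[n+1]C[k+1] (m + suc d) d ⟩
  suc (m + suc d) C suc d ∎
  where open ≡-Reasoning

binomℤ-nonneg : ∀ {n t} k → t ≤ n → binomℤ (+ n - + t) k ≡ (n ∸ t) C k
binomℤ-nonneg {n} {t} k t≤n = cong (λ z → binomℤ z k) (trans (ℤP.m-n≡m⊖n n t) (ℤP.⊖-≥ t≤n))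

binomℤ-neg : ∀ {n t} k → n < t → binomℤ (+ n - + t) k ≡ 0
binomℤ-neg {n} {t} k n<t rewrite ℤP.m-n≡m⊖n n t | ℤP.⊖-< n<t with t ∸ n | ℕP.m<n⇒0<n∸m n<t
... | suc _ | _ = refl

binomℤ-vanishes : ∀ {n t} k → n < t + k → binomℤ (+ n - + t) k ≡ 0
binomℤ-vanishes {n} {t} k n<t+k with t ≤? n
... | no  t≰n = binomℤ-neg k (ℕP.≰⇒> t≰n)
... | yes t≤n = trans (binomℤ-nonneg k t≤n)
  (k>n⇒nCk≡0 (subst (n ∸ t <_) (ℕP.m+n∸m≡n t k) (ℕP.∸-monoˡ-< n<t+k t≤n)))

binomℤ-weak-compositions : ∀ {n t} k → t + k ≤ n → binomℤ (+ n - + t) k ≡ (n ∸ (t + k) + k) C k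
binomℤ-weak-compositions {n} {t} k t+k≤n = trans (binomℤ-nonneg k (ℕP.m+n≤o⇒m≤o t t+k≤n)) (cong (_C k) n∸t≡)
  where
  open ≡-Reasoning
  n∸t≡ : n ∸ t ≡ n ∸ (t + k) + k
  n∸t≡ = begin
    n ∸ t             ≡⟨ ℕP.m∸n+n≡m (subst (_≤ n ∸ t) (ℕP.m+n∸m≡n t k) (ℕP.∸-monoˡ-≤ t t+k≤n)) ⟨
    n ∸ t ∸ k + k     ≡⟨ cong (_+ k) (ℕP.∸-+-assoc n t k) ⟩
    n ∸ (t + k) + k   ∎

∈-shifted-compositions⁺ : ∀ {d n} (y : Vec ℕ d) → sum y + triangle d ≡ n →
  shift y ∈ L.map shift (compositions d (n ∸ triangle d))
∈-shifted-compositions⁺ {d} y Σy≡n = ∈-map⁺ shift (subst (λ m → y ∈ compositions d m) m≡ (∈-compositions⁺ y))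
  where
  m≡ : sum y ≡ _ ∸ triangle d
  m≡ = trans (sym (ℕP.m+n∸n≡m (sum y) (triangle d))) (cong (_∸ triangle d) Σy≡n)

good⇒∈ : ∀ {k n p} → Good (suc k) n p → p ∈ L.map shift (compositions (suc k) (n ∸ triangle (suc k)))
good⇒∈ {k} {n} good =
  let y , p≡shift-y , Σy≡n = good⇒shift good
  in subst (_∈ L.map shift (compositions (suc k) (n ∸ triangle (suc k)))) (sym p≡shift-y) (∈-shifted-compositions⁺ y Σy≡n)

∈⇒good : ∀ {d n p} → triangle d ≤ n → p ∈ L.map shift (compositions d (n ∸ triangle d)) → Good d n p
∈⇒good {d} {n} T≤n p∈ =
  let y , y∈ , p≡shift-y = ∈-map⁻ shift p∈
  in subst (Good d n) (sym p≡shift-y) (shift-good y (trans (cong (_+ triangle d) (∈-compositions⁻ y∈)) (ℕP.m∸n+n≡m T≤n)))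

good⇒triangle≤ : ∀ {k n p} → Good (suc k) n p → triangle (suc k) ≤ n
good⇒triangle≤ {k} good =
  let y , _ , Σy≡n = good⇒shift good
  in subst (triangle (suc k) ≤_) Σy≡n (ℕP.m≤n+m (triangle (suc k)) (sum y))

binomℤ-triangle-closed : ∀ {n} k → binomℤ (+ n - + ((k * (k ∸ 1)) / 2)) k ≡ binomℤ (+ n - + triangle k) k
binomℤ-triangle-closed {n} k = cong (λ t → binomℤ (+ n - + t) k) (triangle-closed k)

proposition3p2 : (d n : ℕ) → 1 ≤ d →
  Σ (List (Vec ℚ d)) (λ L →
    Unique L
    × ((p : Vec ℚ d) → (Good d n p → p ∈ L) × (p ∈ L → Good d n p))
    × (length L ≡ binomℤ (+ n - + (((d ∸ 1) * (d ∸ 2)) / 2)) (d ∸ 1)))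
proposition3p2 (suc k) n _ with triangle (suc k) ≤? n
... | yes T≤n =
  L.map shift (compositions (suc k) m) ,
  UniqueP.map⁺ shift-injective (compositions-unique (suc k) m) ,
  (λ p → good⇒∈ , ∈⇒good T≤n) ,
  (begin
    length (L.map shift (compositions (suc k) m)) ≡⟨ LP.length-map shift (compositions (suc k) m) ⟩
    length (compositions (suc k) m)               ≡⟨ length-compositions k m ⟩
    (m + k) C k                                   ≡⟨ binomℤ-weak-compositions k T≤n ⟨
    binomℤ (+ n - + triangle k) k                 ≡⟨ binomℤ-triangle-closed k ⟨
    binomℤ (+ n - + ((k * (k ∸ 1)) / 2)) k        ∎)
  where
  open ≡-Reasoning
  m = n ∸ triangle (suc k)
... | no T≰n =
  L.[] , [] ,
  (λ p → (λ good → contradiction (good⇒triangle≤ good) T≰n) , λ ()) ,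
  sym (trans (binomℤ-triangle-closed k) (binomℤ-vanishes k (ℕP.≰⇒> T≰n)))
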